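{- For all integers $n\ge1$ and $m,r\ge0$, \[ \sum_{k=1}^{n}(-1)^{k+1}\genfrac{\{}{\}}{0pt}{}{n}{k}_{m}k!\,h_{k}^{(r)}=n(m-r)^{n-1} \qquad\text{and}\qquad \sum_{k=1}^{n}k\genfrac{[}{]}{0pt}{}{n}{k}_{m}r^{k-1}=n!\,h_{n}^{(r+m)}. \]
   Context: For an integer $r\ge0$ and $n\ge0$, $h_n^{(r)}$ is the coefficient of $t^n$ in $\frac{ -\ln(1-t)}{(1-t)^r}$ (equivalently $h_n^{(r)}=\sum_{k=1}^n h_k^{(r-1)}$ for $r\ge1$, $h_k^{(0)}=1/k$). The $r$-Stirling numbers are defined by $(x+m)^{\overline{n}}=\sum_{k=0}^n\genfrac{[}{]}{0pt}{}{n}{k}_m x^k$ and $(x+m)^n=\sum_{k=0}^n\genfrac{\{}{\}}{0pt}{}{n}{k}_m x(x-1)\cdots(x-k+1)$, where $(x)^{\overline{n}}=x(x+1)\cdots(x+n-1)$. -}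

module Defs where

open import Data.Nat as ℕ using (ℕ; zero; suc)
open import Data.Integer as ℤ using (ℤ; +_)
open import Data.Rational as ℚ using (ℚ)
open import Data.List using (List; []; _∷_)

-- Polynomials in x with coefficients in ℕ, as coefficient lists
-- (head = coefficient of x^0).
Poly : Set
Poly = List ℕ

coeff : Poly → ℕ → ℕ
coeff []       _       = 0
coeff (c ∷ _)  zero    = c
coeff (_ ∷ cs) (suc k) = coeff cs k

addP : Poly → Poly → Poly
addP []       q        = q
addP p        []       = p
addP (a ∷ p)  (b ∷ q)  = (a ℕ.+ b) ∷ addP p q

scaleP : ℕ → Poly → Poly
scaleP a []       = []
scaleP a (c ∷ cs) = (a ℕ.* c) ∷ scaleP a cs

mulXplus : ℕ → Poly → Poly
mulXplus a p = addP (0 ∷ p) (scaleP a p)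

risingPoly : ℕ → ℕ → Poly
risingPoly m zero    = 1 ∷ []
risingPoly m (suc n) = mulXplus (m ℕ.+ n) (risingPoly m n)

-- r-Stirling numbers of the first kind: coefficient of x^k in (x+m)^{rising n}
stirling1 : ℕ → ℕ → ℕ → ℕ
stirling1 m n k = coeff (risingPoly m n) k

-- Polynomials in the falling-factorial basis: list c with
-- p(x) = Σ_k c_k · x(x-1)...(x-k+1).
-- Multiplication by (x+a), using x · x^{falling k} = x^{falling (k+1)} + k x^{falling k}:
-- (x+a) Σ c_k x^{falling k} = Σ c_k x^{falling (k+1)} + Σ (k+a) c_k x^{falling k}.
scaleIdx : ℕ → ℕ → Poly → Poly
scaleIdx a k []       = []
scaleIdx a k (c ∷ cs) = ((k ℕ.+ a) ℕ.* c) ∷ scaleIdx a (suc k) cs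

mulXplusFalling : ℕ → Poly → Poly
mulXplusFalling a p = addP (0 ∷ p) (scaleIdx a 0 p)

powFalling : ℕ → ℕ → Poly
powFalling m zero    = 1 ∷ []
powFalling m (suc n) = mulXplusFalling m (powFalling m n)

-- r-Stirling numbers of the second kind: coefficient of x(x-1)...(x-k+1) in (x+m)^n
stirling2 : ℕ → ℕ → ℕ → ℕ
stirling2 m n k = coeff (powFalling m n) k

sumℚ : ℕ → (ℕ → ℚ) → ℚ
sumℚ zero    f = ℚ.0ℚ
sumℚ (suc n) f = sumℚ n f ℚ.+ f (suc n)

sumℕ : ℕ → (ℕ → ℕ) → ℕ
sumℕ zero    f = 0
sumℕ (suc n) f = sumℕ n f ℕ.+ f (suc n)

-- hyperharmonic numbers h_n^{(r)}: coefficient of t^n in -ln(1-t)/(1-t)^r.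
-- h_0^{(0)} = 0, h_k^{(0)} = 1/k, h_n^{(r+1)} = Σ_{k=1}^n h_k^{(r)}.
hh : ℕ → ℕ → ℚ
hh zero    zero    = ℚ.0ℚ
hh zero    (suc k) = (+ 1) ℚ./ suc k
hh (suc r) n       = sumℚ n (λ k → hh r k)

ℕ→ℚ : ℕ → ℚ
ℕ→ℚ n = (+ n) ℚ./ 1

ℤ→ℚ : ℤ → ℚ
ℤ→ℚ z = z ℚ./ 1

sign : ℕ → ℚ
sign zero    = ℚ.1ℚ
sign (suc j) = ℚ.- sign j

-- Both sums are derivatives at a point. Write x^{k̲} = x(x-1)⋯(x-k+1) and
-- x^{k̄} = x(x+1)⋯(x+k-1). At x = -r, (x^{k̲})' = (-1)^{k+1} k! h_k^{(r)}, so the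
-- first sum is d/dx (x+m)^n at x = -r, i.e. n(m-r)^{n-1}. At x = r, (x^k)' = k r^{k-1},
-- so the second sum is d/dx (x+m)^{n̄} at x = r, which is d/dx x^{n̄} at x = r+m.
-- Both facts reduce to the Leibniz rule for multiplication by a linear factor,
-- applied to the linear form "value" or "derivative at a point" on coefficient
-- lists; for the rising factorial this is the recurrence
-- (n+1)! h_{n+1}^{(s)} = (s+n) n! h_n^{(s)} + s(s+1)⋯(s+n-1).
module Submission where

open import Defs
open import Data.Nat as ℕ using (ℕ; zero; suc; _≥_; _∸_; _!; _≤_; z≤n; s≤s)
open import Data.Nat.Tactic.RingSolver using (solve-∀)
import Data.Nat.Properties as ℕP
open import Data.Integer as ℤ using (ℤ; +_)
import Data.Integer.Properties as ℤP
open import Data.Rational as ℚ using (ℚ; 0ℚ; 1ℚ)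
import Data.Rational.Properties as ℚP
open import Data.Rational.Unnormalised as ℚᵘ using (mkℚᵘ; *≡*)
import Data.Rational.Unnormalised.Properties as ℚᵘP
import Data.Rational.Solver as ℚSolver
open ℚSolver.+-*-Solver using (solve; _:+_; _:*_; :-_; _:=_; con)
open import Data.List using ([]; _∷_; length)
open import Data.Product using (_×_; _,_)
open import Relation.Binary.PropositionalEquality
open ≡-Reasoning

toℚᵘ-ℤ→ℚ : ∀ z → ℚ.toℚᵘ (ℤ→ℚ z) ℚᵘ.≃ mkℚᵘ z 0
toℚᵘ-ℤ→ℚ z = ℚP.toℚᵘ-fromℚᵘ (mkℚᵘ z 0)

ℤ→ℚ-+ : ∀ a b → ℤ→ℚ (a ℤ.+ b) ≡ ℤ→ℚ a ℚ.+ ℤ→ℚ b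
ℤ→ℚ-+ a b = ℚP.toℚᵘ-injective (ℚᵘP.≃-trans (toℚᵘ-ℤ→ℚ (a ℤ.+ b)) (ℚᵘP.≃-trans denominators-one
  (ℚᵘP.≃-sym (ℚᵘP.≃-trans (ℚP.toℚᵘ-homo-+ (ℤ→ℚ a) (ℤ→ℚ b))
                          (ℚᵘP.+-cong (toℚᵘ-ℤ→ℚ a) (toℚᵘ-ℤ→ℚ b))))))
  where
  denominators-one : mkℚᵘ (a ℤ.+ b) 0 ℚᵘ.≃ mkℚᵘ a 0 ℚᵘ.+ mkℚᵘ b 0
  denominators-one = *≡* (trans (ℤP.*-identityʳ _)
    (sym (trans (ℤP.*-identityʳ _) (cong₂ ℤ._+_ (ℤP.*-identityʳ a) (ℤP.*-identityʳ b)))))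

ℤ→ℚ-* : ∀ a b → ℤ→ℚ (a ℤ.* b) ≡ ℤ→ℚ a ℚ.* ℤ→ℚ b
ℤ→ℚ-* a b = ℚP.toℚᵘ-injective (ℚᵘP.≃-trans (toℚᵘ-ℤ→ℚ (a ℤ.* b)) (ℚᵘP.≃-trans (*≡* refl)
  (ℚᵘP.≃-sym (ℚᵘP.≃-trans (ℚP.toℚᵘ-homo-* (ℤ→ℚ a) (ℤ→ℚ b))
                          (ℚᵘP.*-cong (toℚᵘ-ℤ→ℚ a) (toℚᵘ-ℤ→ℚ b))))))

ℤ→ℚ-neg : ∀ a → ℤ→ℚ (ℤ.- a) ≡ ℚ.- ℤ→ℚ a
ℤ→ℚ-neg a = ℚP.toℚᵘ-injective (ℚᵘP.≃-trans (toℚᵘ-ℤ→ℚ (ℤ.- a))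
  (ℚᵘP.≃-sym (ℚᵘP.≃-trans (ℚP.toℚᵘ-homo‿- (ℤ→ℚ a)) (ℚᵘP.-‿cong (toℚᵘ-ℤ→ℚ a)))))

ℤ→ℚ-sub-pos : ∀ m r → ℤ→ℚ (+ m ℤ.- + r) ≡ ℕ→ℚ m ℚ.- ℕ→ℚ r
ℤ→ℚ-sub-pos m r = trans (ℤ→ℚ-+ (+ m) (ℤ.- + r)) (cong (ℕ→ℚ m ℚ.+_) (ℤ→ℚ-neg (+ r)))

ℕ→ℚ-+ : ∀ a b → ℕ→ℚ (a ℕ.+ b) ≡ ℕ→ℚ a ℚ.+ ℕ→ℚ b
ℕ→ℚ-+ a b = trans (cong ℤ→ℚ (ℤP.pos-+ a b)) (ℤ→ℚ-+ (+ a) (+ b))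

ℕ→ℚ-* : ∀ a b → ℕ→ℚ (a ℕ.* b) ≡ ℕ→ℚ a ℚ.* ℕ→ℚ b
ℕ→ℚ-* a b = trans (cong ℤ→ℚ (ℤP.pos-* a b)) (ℤ→ℚ-* (+ a) (+ b))

ℕ→ℚ-suc : ∀ n → ℕ→ℚ (suc n) ≡ 1ℚ ℚ.+ ℕ→ℚ n
ℕ→ℚ-suc = ℕ→ℚ-+ 1

ℕ→ℚ-suc-*-inverse : ∀ n → ℕ→ℚ (suc n) ℚ.* ((+ 1) ℚ./ suc n) ≡ 1ℚ
ℕ→ℚ-suc-*-inverse n = ℚP.toℚᵘ-injective
  (ℚᵘP.≃-trans (ℚP.toℚᵘ-homo-* (ℕ→ℚ (suc n)) ((+ 1) ℚ./ suc n))
  (ℚᵘP.≃-trans (ℚᵘP.*-cong (toℚᵘ-ℤ→ℚ (+ suc n)) (ℚP.toℚᵘ-fromℚᵘ (mkℚᵘ (+ 1) n)))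
  (*≡* (cong (λ k → + suc k) (trans (trans (ℕP.*-identityʳ _) (ℕP.*-identityʳ n))
                                    (sym (trans (ℕP.+-identityʳ _) (ℕP.+-identityʳ n))))))))

sumℚ-cong : ∀ n {f g : ℕ → ℚ} → (∀ k → f k ≡ g k) → sumℚ n f ≡ sumℚ n g
sumℚ-cong zero    f≗g = refl
sumℚ-cong (suc n) f≗g = cong₂ ℚ._+_ (sumℚ-cong n f≗g) (f≗g (suc n))

sumℚ-zero : ∀ n {f : ℕ → ℚ} → (∀ k → f k ≡ 0ℚ) → sumℚ n f ≡ 0ℚ
sumℚ-zero zero    f≗0 = refl
sumℚ-zero (suc n) f≗0 = trans (cong₂ ℚ._+_ (sumℚ-zero n f≗0) (f≗0 (suc n))) refl

sumℚ-suc : ∀ n (f : ℕ → ℚ) → sumℚ (suc n) f ≡ f 1 ℚ.+ sumℚ n (λ k → f (suc k))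
sumℚ-suc zero    f = ℚP.+-comm 0ℚ (f 1)
sumℚ-suc (suc n) f = trans (cong (ℚ._+ f (suc (suc n))) (sumℚ-suc n f))
                           (ℚP.+-assoc (f 1) (sumℚ n (λ k → f (suc k))) (f (suc (suc n))))

ℕ→ℚ-sumℕ : ∀ n f → ℕ→ℚ (sumℕ n f) ≡ sumℚ n (λ k → ℕ→ℚ (f k))
ℕ→ℚ-sumℕ zero    f = refl
ℕ→ℚ-sumℕ (suc n) f =
  trans (ℕ→ℚ-+ (sumℕ n f) (f (suc n))) (cong (ℚ._+ ℕ→ℚ (f (suc n))) (ℕ→ℚ-sumℕ n f))

-- The linear form on coefficient lists sending the k-th basis polynomial to w k.
evalBasis : (ℕ → ℚ) → Poly → ℚ
evalBasis w []       = 0ℚ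
evalBasis w (c ∷ cs) = ℕ→ℚ c ℚ.* w 0 ℚ.+ evalBasis (λ k → w (suc k)) cs

evalBasis-cong : ∀ p {u v : ℕ → ℚ} → (∀ k → u k ≡ v k) → evalBasis u p ≡ evalBasis v p
evalBasis-cong []       u≗v = refl
evalBasis-cong (c ∷ cs) u≗v =
  cong₂ ℚ._+_ (cong (ℕ→ℚ c ℚ.*_) (u≗v 0)) (evalBasis-cong cs (λ k → u≗v (suc k)))

evalBasis-+ : ∀ p (u v : ℕ → ℚ) → evalBasis (λ k → u k ℚ.+ v k) p ≡ evalBasis u p ℚ.+ evalBasis v p
evalBasis-+ []       u v = refl
evalBasis-+ (c ∷ cs) u v =
  trans (cong (ℕ→ℚ c ℚ.* (u 0 ℚ.+ v 0) ℚ.+_) (evalBasis-+ cs (λ k → u (suc k)) (λ k → v (suc k))))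
    (solve 5 (λ c a b x y → c :* (a :+ b) :+ (x :+ y) := (c :* a :+ x) :+ (c :* b :+ y)) refl
      (ℕ→ℚ c) (u 0) (v 0) (evalBasis (λ k → u (suc k)) cs) (evalBasis (λ k → v (suc k)) cs))

evalBasis-* : ∀ p α (u : ℕ → ℚ) → evalBasis (λ k → α ℚ.* u k) p ≡ α ℚ.* evalBasis u p
evalBasis-* []       α u = sym (ℚP.*-zeroʳ α)
evalBasis-* (c ∷ cs) α u =
  trans (cong (ℕ→ℚ c ℚ.* (α ℚ.* u 0) ℚ.+_) (evalBasis-* cs α (λ k → u (suc k))))
    (solve 4 (λ c α a x → c :* (α :* a) :+ α :* x := α :* (c :* a :+ x)) refl
      (ℕ→ℚ c) α (u 0) (evalBasis (λ k → u (suc k)) cs))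

evalBasis-addP : ∀ p q (w : ℕ → ℚ) → evalBasis w (addP p q) ≡ evalBasis w p ℚ.+ evalBasis w q
evalBasis-addP []      q       w = sym (ℚP.+-identityˡ _)
evalBasis-addP (a ∷ p) []      w = sym (ℚP.+-identityʳ _)
evalBasis-addP (a ∷ p) (b ∷ q) w = begin
  ℕ→ℚ (a ℕ.+ b) ℚ.* w 0 ℚ.+ evalBasis w′ (addP p q)
    ≡⟨ cong₂ (λ x y → x ℚ.* w 0 ℚ.+ y) (ℕ→ℚ-+ a b) (evalBasis-addP p q w′) ⟩
  (ℕ→ℚ a ℚ.+ ℕ→ℚ b) ℚ.* w 0 ℚ.+ (evalBasis w′ p ℚ.+ evalBasis w′ q)
    ≡⟨ solve 5 (λ a b c x y → (a :+ b) :* c :+ (x :+ y) := (a :* c :+ x) :+ (b :* c :+ y)) refl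
         (ℕ→ℚ a) (ℕ→ℚ b) (w 0) (evalBasis w′ p) (evalBasis w′ q) ⟩
  (ℕ→ℚ a ℚ.* w 0 ℚ.+ evalBasis w′ p) ℚ.+ (ℕ→ℚ b ℚ.* w 0 ℚ.+ evalBasis w′ q) ∎
  where w′ = λ k → w (suc k)

evalBasis-scaleP : ∀ a p (w : ℕ → ℚ) → evalBasis w (scaleP a p) ≡ ℕ→ℚ a ℚ.* evalBasis w p
evalBasis-scaleP a []       w = sym (ℚP.*-zeroʳ (ℕ→ℚ a))
evalBasis-scaleP a (c ∷ cs) w =
  trans (cong₂ (λ x y → x ℚ.* w 0 ℚ.+ y) (ℕ→ℚ-* a c) (evalBasis-scaleP a cs (λ k → w (suc k))))
    (solve 4 (λ a c x y → a :* c :* x :+ a :* y := a :* (c :* x :+ y)) refl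
      (ℕ→ℚ a) (ℕ→ℚ c) (w 0) (evalBasis (λ k → w (suc k)) cs))

evalBasis-scaleIdx : ∀ a k p (w : ℕ → ℚ) →
  evalBasis w (scaleIdx a k p) ≡ evalBasis (λ i → ℕ→ℚ (i ℕ.+ (k ℕ.+ a)) ℚ.* w i) p
evalBasis-scaleIdx a k []       w = refl
evalBasis-scaleIdx a k (c ∷ cs) w = cong₂ ℚ._+_
  (trans (cong (ℚ._* w 0) (ℕ→ℚ-* (k ℕ.+ a) c))
    (solve 3 (λ a c x → a :* c :* x := c :* (a :* x)) refl (ℕ→ℚ (k ℕ.+ a)) (ℕ→ℚ c) (w 0)))
  (trans (evalBasis-scaleIdx a (suc k) cs (λ i → w (suc i)))
    (evalBasis-cong cs (λ i → cong (λ j → ℕ→ℚ j ℚ.* w (suc i)) (ℕP.+-suc i (k ℕ.+ a)))))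

evalBasis-0∷ : ∀ p (w : ℕ → ℚ) → evalBasis w (0 ∷ p) ≡ evalBasis (λ k → w (suc k)) p
evalBasis-0∷ p w = trans (cong (ℚ._+ evalBasis (λ k → w (suc k)) p) (ℚP.*-zeroˡ (w 0))) (ℚP.+-identityˡ _)

evalBasis-mulXplus : ∀ a p (w : ℕ → ℚ) →
  evalBasis w (mulXplus a p) ≡ evalBasis (λ k → w (suc k)) p ℚ.+ ℕ→ℚ a ℚ.* evalBasis w p
evalBasis-mulXplus a p w =
  trans (evalBasis-addP (0 ∷ p) (scaleP a p) w) (cong₂ ℚ._+_ (evalBasis-0∷ p w) (evalBasis-scaleP a p w))

evalBasis-mulXplusFalling : ∀ a p (w : ℕ → ℚ) →
  evalBasis w (mulXplusFalling a p) ≡ evalBasis (λ k → w (suc k) ℚ.+ ℕ→ℚ (k ℕ.+ a) ℚ.* w k) p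
evalBasis-mulXplusFalling a p w = begin
  evalBasis w (addP (0 ∷ p) (scaleIdx a 0 p))
    ≡⟨ evalBasis-addP (0 ∷ p) (scaleIdx a 0 p) w ⟩
  evalBasis w (0 ∷ p) ℚ.+ evalBasis w (scaleIdx a 0 p)
    ≡⟨ cong₂ ℚ._+_ (evalBasis-0∷ p w) (evalBasis-scaleIdx a 0 p w) ⟩
  evalBasis (λ k → w (suc k)) p ℚ.+ evalBasis (λ k → ℕ→ℚ (k ℕ.+ a) ℚ.* w k) p
    ≡⟨ sym (evalBasis-+ p (λ k → w (suc k)) (λ k → ℕ→ℚ (k ℕ.+ a) ℚ.* w k)) ⟩
  evalBasis (λ k → w (suc k) ℚ.+ ℕ→ℚ (k ℕ.+ a) ℚ.* w k) p ∎

coeffSum≡evalBasis : ∀ p (w : ℕ → ℚ) n → length p ≤ suc n →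
  ℕ→ℚ (coeff p 0) ℚ.* w 0 ℚ.+ sumℚ n (λ k → ℕ→ℚ (coeff p k) ℚ.* w k) ≡ evalBasis w p
coeffSum≡evalBasis []           w n       _         =
  cong₂ ℚ._+_ (ℚP.*-zeroˡ (w 0)) (sumℚ-zero n (λ k → ℚP.*-zeroˡ (w k)))
coeffSum≡evalBasis (c ∷ [])     w zero    _         = refl
coeffSum≡evalBasis (c ∷ _ ∷ _)  w zero    (s≤s ())
coeffSum≡evalBasis (c ∷ cs)     w (suc n) (s≤s len) = cong (ℕ→ℚ c ℚ.* w 0 ℚ.+_)
  (trans (sumℚ-suc n (λ k → ℕ→ℚ (coeff (c ∷ cs) k) ℚ.* w k)) (coeffSum≡evalBasis cs (λ k → w (suc k)) n len))

sum≡evalBasis : ∀ p (w : ℕ → ℚ) n → w 0 ≡ 0ℚ → length p ≤ suc n →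
  sumℚ n (λ k → ℕ→ℚ (coeff p k) ℚ.* w k) ≡ evalBasis w p
sum≡evalBasis p w n w0≡0 len = begin
  sumℚ n f                              ≡⟨ sym (ℚP.+-identityˡ _) ⟩
  0ℚ ℚ.+ sumℚ n f                       ≡⟨ cong (ℚ._+ sumℚ n f) constant-term-vanishes ⟩
  ℕ→ℚ (coeff p 0) ℚ.* w 0 ℚ.+ sumℚ n f  ≡⟨ coeffSum≡evalBasis p w n len ⟩
  evalBasis w p                         ∎
  where
  f = λ k → ℕ→ℚ (coeff p k) ℚ.* w k
  constant-term-vanishes : 0ℚ ≡ ℕ→ℚ (coeff p 0) ℚ.* w 0
  constant-term-vanishes = sym (trans (cong (ℕ→ℚ (coeff p 0) ℚ.*_) w0≡0) (ℚP.*-zeroʳ (ℕ→ℚ (coeff p 0))))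

length-addP : ∀ p q {l} → length p ≤ l → length q ≤ l → length (addP p q) ≤ l
length-addP []      q       _         q≤l       = q≤l
length-addP (a ∷ p) []      p≤l       _         = p≤l
length-addP (a ∷ p) (b ∷ q) (s≤s p≤l) (s≤s q≤l) = s≤s (length-addP p q p≤l q≤l)

length-scaleP : ∀ a p → length (scaleP a p) ≡ length p
length-scaleP a []       = refl
length-scaleP a (c ∷ cs) = cong suc (length-scaleP a cs)

length-scaleIdx : ∀ a k p → length (scaleIdx a k p) ≡ length p
length-scaleIdx a k []       = refl
length-scaleIdx a k (c ∷ cs) = cong suc (length-scaleIdx a (suc k) cs)

length-risingPoly : ∀ m n → length (risingPoly m n) ≤ suc n
length-risingPoly m zero    = s≤s z≤n
length-risingPoly m (suc n) = length-addP (0 ∷ p) (scaleP (m ℕ.+ n) p) (s≤s len)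
  (subst (_≤ suc (suc n)) (sym (length-scaleP (m ℕ.+ n) p)) (ℕP.m≤n⇒m≤1+n len))
  where p = risingPoly m n; len = length-risingPoly m n

length-powFalling : ∀ m n → length (powFalling m n) ≤ suc n
length-powFalling m zero    = s≤s z≤n
length-powFalling m (suc n) = length-addP (0 ∷ p) (scaleIdx m 0 p) (s≤s len)
  (subst (_≤ suc (suc n)) (sym (length-scaleIdx m 0 p)) (ℕP.m≤n⇒m≤1+n len))
  where p = powFalling m n; len = length-powFalling m n

rising : ℕ → ℕ → ℕ
rising s zero    = 1
rising s (suc n) = (s ℕ.+ n) ℕ.* rising s n

rising-zero-suc : ∀ n → rising 0 (suc n) ≡ 0
rising-zero-suc zero    = refl
rising-zero-suc (suc n) = trans (cong (suc n ℕ.*_) (rising-zero-suc n)) (ℕP.*-zeroʳ n)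

rising-shift : ∀ s n → s ℕ.* rising (suc s) n ≡ (s ℕ.+ n) ℕ.* rising s n
rising-shift s zero    = cong (ℕ._* 1) (sym (ℕP.+-identityʳ s))
rising-shift s (suc n) = begin
  s ℕ.* ((suc s ℕ.+ n) ℕ.* rising (suc s) n)   ≡⟨ left-swap s (suc s ℕ.+ n) (rising (suc s) n) ⟩
  (suc s ℕ.+ n) ℕ.* (s ℕ.* rising (suc s) n)   ≡⟨ cong ((suc s ℕ.+ n) ℕ.*_) (rising-shift s n) ⟩
  suc (s ℕ.+ n) ℕ.* ((s ℕ.+ n) ℕ.* rising s n) ≡⟨ cong (ℕ._* ((s ℕ.+ n) ℕ.* rising s n)) (sym (ℕP.+-suc s n)) ⟩
  (s ℕ.+ suc n) ℕ.* ((s ℕ.+ n) ℕ.* rising s n) ∎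
  where
  left-swap : ∀ a b c → a ℕ.* (b ℕ.* c) ≡ b ℕ.* (a ℕ.* c)
  left-swap = solve-∀

rising-suc-suc : ∀ s n → rising (suc s) (suc n) ≡ suc n ℕ.* rising (suc s) n ℕ.+ rising s (suc n)
rising-suc-suc s n = begin
  (suc s ℕ.+ n) ℕ.* x             ≡⟨ split-sum s n x ⟩
  suc n ℕ.* x ℕ.+ s ℕ.* x         ≡⟨ cong (suc n ℕ.* x ℕ.+_) (rising-shift s n) ⟩
  suc n ℕ.* x ℕ.+ rising s (suc n) ∎
  where
  x = rising (suc s) n
  split-sum : ∀ a b c → (suc a ℕ.+ b) ℕ.* c ≡ suc b ℕ.* c ℕ.+ a ℕ.* c
  split-sum = solve-∀

hh-zero : ∀ s → hh s 0 ≡ 0ℚ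
hh-zero zero    = refl
hh-zero (suc s) = refl

hh-one : ∀ s → hh s 1 ≡ 1ℚ
hh-one zero    = refl
hh-one (suc s) = trans (ℚP.+-identityˡ _) (hh-one s)

-- n! h_n^{(s)}: the derivative of x(x+1)⋯(x+n-1) at x = s, for which
-- factorialHH-recurrence is the Leibniz rule.
factorialHH : ℕ → ℕ → ℚ
factorialHH s n = ℕ→ℚ (n !) ℚ.* hh s n

factorialHH-suc-suc : ∀ s n →
  factorialHH (suc s) (suc n) ≡ ℕ→ℚ (suc n) ℚ.* factorialHH (suc s) n ℚ.+ factorialHH s (suc n)
factorialHH-suc-suc s n = begin
  ℕ→ℚ (suc n ℕ.* n !) ℚ.* (hh (suc s) n ℚ.+ hh s (suc n))
    ≡⟨ cong (ℚ._* (hh (suc s) n ℚ.+ hh s (suc n))) (ℕ→ℚ-* (suc n) (n !)) ⟩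
  (ℕ→ℚ (suc n) ℚ.* ℕ→ℚ (n !)) ℚ.* (hh (suc s) n ℚ.+ hh s (suc n))
    ≡⟨ solve 4 (λ a b x y → (a :* b) :* (x :+ y) := a :* (b :* x) :+ (a :* b) :* y) refl
         (ℕ→ℚ (suc n)) (ℕ→ℚ (n !)) (hh (suc s) n) (hh s (suc n)) ⟩
  ℕ→ℚ (suc n) ℚ.* factorialHH (suc s) n ℚ.+ (ℕ→ℚ (suc n) ℚ.* ℕ→ℚ (n !)) ℚ.* hh s (suc n)
    ≡⟨ cong (λ z → ℕ→ℚ (suc n) ℚ.* factorialHH (suc s) n ℚ.+ z ℚ.* hh s (suc n)) (sym (ℕ→ℚ-* (suc n) (n !))) ⟩
  ℕ→ℚ (suc n) ℚ.* factorialHH (suc s) n ℚ.+ factorialHH s (suc n) ∎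

factorialHH-zero-suc : ∀ n → factorialHH 0 (suc n) ≡ ℕ→ℚ (n !)
factorialHH-zero-suc n = begin
  ℕ→ℚ (suc n ℕ.* n !) ℚ.* ((+ 1) ℚ./ suc n)
    ≡⟨ cong (ℚ._* ((+ 1) ℚ./ suc n)) (ℕ→ℚ-* (suc n) (n !)) ⟩
  (ℕ→ℚ (suc n) ℚ.* ℕ→ℚ (n !)) ℚ.* ((+ 1) ℚ./ suc n)
    ≡⟨ solve 3 (λ a b c → (a :* b) :* c := b :* (a :* c)) refl (ℕ→ℚ (suc n)) (ℕ→ℚ (n !)) ((+ 1) ℚ./ suc n) ⟩
  ℕ→ℚ (n !) ℚ.* (ℕ→ℚ (suc n) ℚ.* ((+ 1) ℚ./ suc n))
    ≡⟨ cong (ℕ→ℚ (n !) ℚ.*_) (ℕ→ℚ-suc-*-inverse n) ⟩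
  ℕ→ℚ (n !) ℚ.* 1ℚ
    ≡⟨ ℚP.*-identityʳ _ ⟩
  ℕ→ℚ (n !) ∎

FactorialHHRecurrence : ℕ → Set
FactorialHHRecurrence s =
  ∀ n → factorialHH s (suc n) ≡ ℕ→ℚ (s ℕ.+ n) ℚ.* factorialHH s n ℚ.+ ℕ→ℚ (rising s n)

-- The Leibniz rule for the other factorisation x(x+1)⋯(x+n) = x · (x+1)⋯(x+n); the
-- recurrence for s+1 is derived from it in factorialHH-recurrence.
factorialHH-shift : ∀ s → FactorialHHRecurrence s →
  ∀ n → factorialHH s (suc n) ≡ ℕ→ℚ s ℚ.* factorialHH (suc s) n ℚ.+ ℕ→ℚ (rising (suc s) n)
factorialHH-shift s rec zero = begin
  ℕ→ℚ 1 ℚ.* hh s 1               ≡⟨ cong (ℕ→ℚ 1 ℚ.*_) (hh-one s) ⟩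
  1ℚ                             ≡⟨ sym (ℚP.+-identityˡ 1ℚ) ⟩
  0ℚ ℚ.+ 1ℚ                      ≡⟨ cong (ℚ._+ 1ℚ) (sym (ℚP.*-zeroʳ (ℕ→ℚ s))) ⟩
  ℕ→ℚ s ℚ.* 0ℚ ℚ.+ 1ℚ            ∎
factorialHH-shift s rec (suc n) = begin
  factorialHH s (suc (suc n))
    ≡⟨ rec (suc n) ⟩
  ℕ→ℚ (s ℕ.+ suc n) ℚ.* factorialHH s (suc n) ℚ.+ b
    ≡⟨ cong₂ (λ u v → u ℚ.* v ℚ.+ b) (ℕ→ℚ-+ s (suc n)) (factorialHH-shift s rec n) ⟩
  (S ℚ.+ N) ℚ.* (S ℚ.* X ℚ.+ a) ℚ.+ b
    ≡⟨ solve 5 (λ S N X a b → (S :+ N) :* (S :* X :+ a) :+ b := S :* (N :* X :+ (S :* X :+ a)) :+ (N :* a :+ b))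
         refl S N X a b ⟩
  S ℚ.* (N ℚ.* X ℚ.+ (S ℚ.* X ℚ.+ a)) ℚ.+ (N ℚ.* a ℚ.+ b)
    ≡⟨ sym (cong₂ (λ u v → S ℚ.* (N ℚ.* X ℚ.+ u) ℚ.+ v) (factorialHH-shift s rec n) ℕ→ℚ-rising-suc-suc) ⟩
  S ℚ.* (N ℚ.* X ℚ.+ factorialHH s (suc n)) ℚ.+ ℕ→ℚ (rising (suc s) (suc n))
    ≡⟨ sym (cong (λ z → S ℚ.* z ℚ.+ ℕ→ℚ (rising (suc s) (suc n))) (factorialHH-suc-suc s n)) ⟩
  S ℚ.* factorialHH (suc s) (suc n) ℚ.+ ℕ→ℚ (rising (suc s) (suc n)) ∎
  where
  S = ℕ→ℚ s; N = ℕ→ℚ (suc n); X = factorialHH (suc s) n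
  a = ℕ→ℚ (rising (suc s) n); b = ℕ→ℚ (rising s (suc n))
  ℕ→ℚ-rising-suc-suc : ℕ→ℚ (rising (suc s) (suc n)) ≡ N ℚ.* a ℚ.+ b
  ℕ→ℚ-rising-suc-suc = trans (cong ℕ→ℚ (rising-suc-suc s n))
    (trans (ℕ→ℚ-+ (suc n ℕ.* rising (suc s) n) (rising s (suc n))) (cong (ℚ._+ b) (ℕ→ℚ-* (suc n) (rising (suc s) n))))

factorialHH-recurrence : ∀ s → FactorialHHRecurrence s
factorialHH-recurrence zero    zero    = refl
factorialHH-recurrence zero    (suc n) = begin
  factorialHH 0 (suc (suc n))                                         ≡⟨ factorialHH-zero-suc (suc n) ⟩
  ℕ→ℚ (suc n ℕ.* n !)                                                 ≡⟨ ℕ→ℚ-* (suc n) (n !) ⟩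
  ℕ→ℚ (suc n) ℚ.* ℕ→ℚ (n !)                                           ≡⟨ sym (ℚP.+-identityʳ _) ⟩
  ℕ→ℚ (suc n) ℚ.* ℕ→ℚ (n !) ℚ.+ 0ℚ
    ≡⟨ cong₂ (λ u v → ℕ→ℚ (suc n) ℚ.* u ℚ.+ ℕ→ℚ v) (sym (factorialHH-zero-suc n)) (sym (rising-zero-suc n)) ⟩
  ℕ→ℚ (suc n) ℚ.* factorialHH 0 (suc n) ℚ.+ ℕ→ℚ (rising 0 (suc n))   ∎
factorialHH-recurrence (suc s) n = begin
  factorialHH (suc s) (suc n)
    ≡⟨ factorialHH-suc-suc s n ⟩
  N ℚ.* X ℚ.+ factorialHH s (suc n)
    ≡⟨ cong (N ℚ.* X ℚ.+_) (factorialHH-shift s (factorialHH-recurrence s) n) ⟩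
  N ℚ.* X ℚ.+ (S ℚ.* X ℚ.+ a)
    ≡⟨ solve 4 (λ N S X a → N :* X :+ (S :* X :+ a) := (S :+ N) :* X :+ a) refl N S X a ⟩
  (S ℚ.+ N) ℚ.* X ℚ.+ a
    ≡⟨ cong (λ z → z ℚ.* X ℚ.+ a) (sym (trans (cong ℕ→ℚ (sym (ℕP.+-suc s n))) (ℕ→ℚ-+ s (suc n)))) ⟩
  ℕ→ℚ (suc s ℕ.+ n) ℚ.* X ℚ.+ a ∎
  where
  S = ℕ→ℚ s; N = ℕ→ℚ (suc n); X = factorialHH (suc s) n; a = ℕ→ℚ (rising (suc s) n)

-- At x = -r, the falling factorial x(x-1)⋯(x-k+1) has value fallingValue r k and
-- derivative fallingSlope r k.
fallingValue : ℕ → ℕ → ℚ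
fallingValue r k = sign k ℚ.* ℕ→ℚ (rising r k)

fallingSlope : ℕ → ℕ → ℚ
fallingSlope r k = sign (suc k) ℚ.* factorialHH r k

fallingSlope-zero : ∀ r → fallingSlope r 0 ≡ 0ℚ
fallingSlope-zero r = cong (λ h → sign 1 ℚ.* (ℕ→ℚ 1 ℚ.* h)) (hh-zero r)

fallingValue-step : ∀ r a i →
  fallingValue r (suc i) ℚ.+ ℕ→ℚ (i ℕ.+ a) ℚ.* fallingValue r i ≡ (ℕ→ℚ a ℚ.- ℕ→ℚ r) ℚ.* fallingValue r i
fallingValue-step r a i = begin
  ℚ.- σ ℚ.* ℕ→ℚ ((r ℕ.+ i) ℕ.* rising r i) ℚ.+ ℕ→ℚ (i ℕ.+ a) ℚ.* (σ ℚ.* ρ)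
    ≡⟨ cong₂ (λ u v → ℚ.- σ ℚ.* u ℚ.+ v ℚ.* (σ ℚ.* ρ))
         (trans (ℕ→ℚ-* (r ℕ.+ i) (rising r i)) (cong (ℚ._* ρ) (ℕ→ℚ-+ r i))) (ℕ→ℚ-+ i a) ⟩
  ℚ.- σ ℚ.* ((R ℚ.+ I) ℚ.* ρ) ℚ.+ (I ℚ.+ A) ℚ.* (σ ℚ.* ρ)
    ≡⟨ solve 5 (λ σ ρ R I A → (:- σ) :* ((R :+ I) :* ρ) :+ (I :+ A) :* (σ :* ρ) := (A :+ (:- R)) :* (σ :* ρ))
         refl σ ρ R I A ⟩
  (A ℚ.- R) ℚ.* (σ ℚ.* ρ) ∎
  where σ = sign i; ρ = ℕ→ℚ (rising r i); R = ℕ→ℚ r; I = ℕ→ℚ i; A = ℕ→ℚ a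

fallingSlope-step : ∀ r a i →
  fallingSlope r (suc i) ℚ.+ ℕ→ℚ (i ℕ.+ a) ℚ.* fallingSlope r i
    ≡ fallingValue r i ℚ.+ (ℕ→ℚ a ℚ.- ℕ→ℚ r) ℚ.* fallingSlope r i
fallingSlope-step r a i = begin
  ℚ.- (ℚ.- σ) ℚ.* factorialHH r (suc i) ℚ.+ ℕ→ℚ (i ℕ.+ a) ℚ.* (ℚ.- σ ℚ.* X)
    ≡⟨ cong₂ (λ u v → ℚ.- (ℚ.- σ) ℚ.* u ℚ.+ v ℚ.* (ℚ.- σ ℚ.* X)) (factorialHH-recurrence r i) (ℕ→ℚ-+ i a) ⟩
  ℚ.- (ℚ.- σ) ℚ.* (ℕ→ℚ (r ℕ.+ i) ℚ.* X ℚ.+ ρ) ℚ.+ (I ℚ.+ A) ℚ.* (ℚ.- σ ℚ.* X)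
    ≡⟨ cong (λ u → ℚ.- (ℚ.- σ) ℚ.* (u ℚ.* X ℚ.+ ρ) ℚ.+ (I ℚ.+ A) ℚ.* (ℚ.- σ ℚ.* X)) (ℕ→ℚ-+ r i) ⟩
  ℚ.- (ℚ.- σ) ℚ.* ((R ℚ.+ I) ℚ.* X ℚ.+ ρ) ℚ.+ (I ℚ.+ A) ℚ.* (ℚ.- σ ℚ.* X)
    ≡⟨ solve 6 (λ σ X ρ R I A → (:- (:- σ)) :* ((R :+ I) :* X :+ ρ) :+ (I :+ A) :* ((:- σ) :* X)
                                := σ :* ρ :+ (A :+ (:- R)) :* ((:- σ) :* X))
         refl σ X ρ R I A ⟩
  σ ℚ.* ρ ℚ.+ (A ℚ.- R) ℚ.* (ℚ.- σ ℚ.* X) ∎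
  where σ = sign i; X = factorialHH r i; ρ = ℕ→ℚ (rising r i); R = ℕ→ℚ r; I = ℕ→ℚ i; A = ℕ→ℚ a

evalBasis-mulXplusFalling-step : ∀ a p (u v : ℕ → ℚ) β →
  (∀ i → u (suc i) ℚ.+ ℕ→ℚ (i ℕ.+ a) ℚ.* u i ≡ v i ℚ.+ β ℚ.* u i) →
  evalBasis u (mulXplusFalling a p) ≡ evalBasis v p ℚ.+ β ℚ.* evalBasis u p
evalBasis-mulXplusFalling-step a p u v β step = begin
  evalBasis u (mulXplusFalling a p)                       ≡⟨ evalBasis-mulXplusFalling a p u ⟩
  evalBasis (λ i → u (suc i) ℚ.+ ℕ→ℚ (i ℕ.+ a) ℚ.* u i) p ≡⟨ evalBasis-cong p step ⟩
  evalBasis (λ i → v i ℚ.+ β ℚ.* u i) p                   ≡⟨ evalBasis-+ p v (λ i → β ℚ.* u i) ⟩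
  evalBasis v p ℚ.+ evalBasis (λ i → β ℚ.* u i) p         ≡⟨ cong (evalBasis v p ℚ.+_) (evalBasis-* p β u) ⟩
  evalBasis v p ℚ.+ β ℚ.* evalBasis u p                   ∎

module _ (r m : ℕ) where

  private
    δ : ℤ
    δ = + m ℤ.- + r

  fallingValue-powFalling : ∀ n → evalBasis (fallingValue r) (powFalling m n) ≡ ℤ→ℚ (δ ℤ.^ n)
  fallingValue-powFalling zero    = refl
  fallingValue-powFalling (suc n) = begin
    evalBasis (fallingValue r) (mulXplusFalling m p)
      ≡⟨ evalBasis-mulXplusFalling m p (fallingValue r) ⟩
    evalBasis (λ i → fallingValue r (suc i) ℚ.+ ℕ→ℚ (i ℕ.+ m) ℚ.* fallingValue r i) p
      ≡⟨ evalBasis-cong p (fallingValue-step r m) ⟩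
    evalBasis (λ i → (ℕ→ℚ m ℚ.- ℕ→ℚ r) ℚ.* fallingValue r i) p
      ≡⟨ evalBasis-* p (ℕ→ℚ m ℚ.- ℕ→ℚ r) (fallingValue r) ⟩
    (ℕ→ℚ m ℚ.- ℕ→ℚ r) ℚ.* evalBasis (fallingValue r) p
      ≡⟨ cong₂ ℚ._*_ (sym (ℤ→ℚ-sub-pos m r)) (fallingValue-powFalling n) ⟩
    ℤ→ℚ δ ℚ.* ℤ→ℚ (δ ℤ.^ n)
      ≡⟨ sym (ℤ→ℚ-* δ (δ ℤ.^ n)) ⟩
    ℤ→ℚ (δ ℤ.^ suc n) ∎
    where p = powFalling m n

  fallingSlope-powFalling-suc : ∀ n →
    evalBasis (fallingSlope r) (powFalling m (suc n))
      ≡ ℤ→ℚ (δ ℤ.^ n) ℚ.+ ℤ→ℚ δ ℚ.* evalBasis (fallingSlope r) (powFalling m n)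
  fallingSlope-powFalling-suc n = begin
    evalBasis (fallingSlope r) (mulXplusFalling m p)
      ≡⟨ evalBasis-mulXplusFalling-step m p (fallingSlope r) (fallingValue r) (ℕ→ℚ m ℚ.- ℕ→ℚ r)
           (fallingSlope-step r m) ⟩
    evalBasis (fallingValue r) p ℚ.+ (ℕ→ℚ m ℚ.- ℕ→ℚ r) ℚ.* evalBasis (fallingSlope r) p
      ≡⟨ cong₂ (λ u v → u ℚ.+ v ℚ.* evalBasis (fallingSlope r) p) (fallingValue-powFalling n) (sym (ℤ→ℚ-sub-pos m r)) ⟩
    ℤ→ℚ (δ ℤ.^ n) ℚ.+ ℤ→ℚ δ ℚ.* evalBasis (fallingSlope r) p ∎
    where p = powFalling m n

  fallingSlope-powFalling : ∀ n → evalBasis (fallingSlope r) (powFalling m (suc n)) ≡ ℕ→ℚ (suc n) ℚ.* ℤ→ℚ (δ ℤ.^ n)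
  fallingSlope-powFalling zero = begin
    evalBasis (fallingSlope r) (powFalling m 1)                     ≡⟨ fallingSlope-powFalling-suc 0 ⟩
    1ℚ ℚ.+ ℤ→ℚ δ ℚ.* (ℕ→ℚ 1 ℚ.* fallingSlope r 0 ℚ.+ 0ℚ)          ≡⟨ cong (λ h → 1ℚ ℚ.+ ℤ→ℚ δ ℚ.* (ℕ→ℚ 1 ℚ.* h ℚ.+ 0ℚ)) (fallingSlope-zero r) ⟩
    1ℚ ℚ.+ ℤ→ℚ δ ℚ.* 0ℚ                                            ≡⟨ cong (1ℚ ℚ.+_) (ℚP.*-zeroʳ (ℤ→ℚ δ)) ⟩
    1ℚ                                                             ∎
  fallingSlope-powFalling (suc n) = begin
    evalBasis (fallingSlope r) (powFalling m (suc (suc n)))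
      ≡⟨ fallingSlope-powFalling-suc (suc n) ⟩
    ℤ→ℚ (δ ℤ.^ suc n) ℚ.+ ℤ→ℚ δ ℚ.* evalBasis (fallingSlope r) (powFalling m (suc n))
      ≡⟨ cong₂ (λ u v → u ℚ.+ ℤ→ℚ δ ℚ.* v) (ℤ→ℚ-* δ (δ ℤ.^ n)) (fallingSlope-powFalling n) ⟩
    d ℚ.* x ℚ.+ d ℚ.* (ℕ→ℚ (suc n) ℚ.* x)
      ≡⟨ solve 3 (λ d x N → d :* x :+ d :* (N :* x) := (con 1ℚ :+ N) :* (d :* x)) refl d x (ℕ→ℚ (suc n)) ⟩
    (1ℚ ℚ.+ ℕ→ℚ (suc n)) ℚ.* (d ℚ.* x)
      ≡⟨ cong₂ ℚ._*_ (sym (ℕ→ℚ-suc (suc n))) (sym (ℤ→ℚ-* δ (δ ℤ.^ n))) ⟩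
    ℕ→ℚ (suc (suc n)) ℚ.* ℤ→ℚ (δ ℤ.^ suc n) ∎
    where d = ℤ→ℚ δ; x = ℤ→ℚ (δ ℤ.^ n)

-- At x = r, the monomial x^k has value powerValue r k and derivative powerSlope r k.
powerValue : ℕ → ℕ → ℚ
powerValue r k = ℕ→ℚ (r ℕ.^ k)

powerSlope : ℕ → ℕ → ℚ
powerSlope r k = ℕ→ℚ (k ℕ.* r ℕ.^ (k ∸ 1))

powerValue-suc : ∀ r k → powerValue r (suc k) ≡ ℕ→ℚ r ℚ.* powerValue r k
powerValue-suc r k = ℕ→ℚ-* r (r ℕ.^ k)

suc-*-^ : ∀ r k → suc k ℕ.* r ℕ.^ k ≡ r ℕ.^ k ℕ.+ r ℕ.* (k ℕ.* r ℕ.^ (k ∸ 1))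
suc-*-^ r zero    = cong (1 ℕ.+_) (sym (ℕP.*-zeroʳ r))
suc-*-^ r (suc k) = lemma r (suc k) (r ℕ.^ k)
  where
  lemma : ∀ r k x → suc k ℕ.* (r ℕ.* x) ≡ r ℕ.* x ℕ.+ r ℕ.* (k ℕ.* x)
  lemma = solve-∀

powerSlope-suc : ∀ r k → powerSlope r (suc k) ≡ powerValue r k ℚ.+ ℕ→ℚ r ℚ.* powerSlope r k
powerSlope-suc r k = trans (cong ℕ→ℚ (suc-*-^ r k))
  (trans (ℕ→ℚ-+ (r ℕ.^ k) _) (cong (powerValue r k ℚ.+_) (ℕ→ℚ-* r (k ℕ.* r ℕ.^ (k ∸ 1)))))

module _ (r m : ℕ) where

  private
    ℕ→ℚ-+-assoc : ∀ n → ℕ→ℚ (r ℕ.+ m ℕ.+ n) ≡ ℕ→ℚ r ℚ.+ ℕ→ℚ (m ℕ.+ n)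
    ℕ→ℚ-+-assoc n = trans (cong ℕ→ℚ (ℕP.+-assoc r m n)) (ℕ→ℚ-+ r (m ℕ.+ n))

  powerValue-risingPoly : ∀ n → evalBasis (powerValue r) (risingPoly m n) ≡ ℕ→ℚ (rising (r ℕ.+ m) n)
  powerValue-risingPoly zero    = refl
  powerValue-risingPoly (suc n) = begin
    evalBasis (powerValue r) (mulXplus (m ℕ.+ n) p)
      ≡⟨ evalBasis-mulXplus (m ℕ.+ n) p (powerValue r) ⟩
    evalBasis (λ k → powerValue r (suc k)) p ℚ.+ A ℚ.* v
      ≡⟨ cong (ℚ._+ A ℚ.* v) (trans (evalBasis-cong p (powerValue-suc r)) (evalBasis-* p R (powerValue r))) ⟩
    R ℚ.* v ℚ.+ A ℚ.* v
      ≡⟨ sym (ℚP.*-distribʳ-+ v R A) ⟩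
    (R ℚ.+ A) ℚ.* v
      ≡⟨ cong₂ ℚ._*_ (sym (ℕ→ℚ-+-assoc n)) (powerValue-risingPoly n) ⟩
    ℕ→ℚ (r ℕ.+ m ℕ.+ n) ℚ.* ℕ→ℚ (rising (r ℕ.+ m) n)
      ≡⟨ sym (ℕ→ℚ-* (r ℕ.+ m ℕ.+ n) (rising (r ℕ.+ m) n)) ⟩
    ℕ→ℚ (rising (r ℕ.+ m) (suc n)) ∎
    where p = risingPoly m n; v = evalBasis (powerValue r) p; R = ℕ→ℚ r; A = ℕ→ℚ (m ℕ.+ n)

  powerSlope-risingPoly : ∀ n → evalBasis (powerSlope r) (risingPoly m n) ≡ factorialHH (r ℕ.+ m) n
  powerSlope-risingPoly zero    = sym (cong (ℕ→ℚ 1 ℚ.*_) (hh-zero (r ℕ.+ m)))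
  powerSlope-risingPoly (suc n) = begin
    evalBasis (powerSlope r) (mulXplus (m ℕ.+ n) p)
      ≡⟨ evalBasis-mulXplus (m ℕ.+ n) p (powerSlope r) ⟩
    evalBasis (λ k → powerSlope r (suc k)) p ℚ.+ A ℚ.* d
      ≡⟨ cong (ℚ._+ A ℚ.* d) (begin
           evalBasis (λ k → powerSlope r (suc k)) p
             ≡⟨ evalBasis-cong p (powerSlope-suc r) ⟩
           evalBasis (λ k → powerValue r k ℚ.+ R ℚ.* powerSlope r k) p
             ≡⟨ evalBasis-+ p (powerValue r) (λ k → R ℚ.* powerSlope r k) ⟩
           evalBasis (powerValue r) p ℚ.+ evalBasis (λ k → R ℚ.* powerSlope r k) p
             ≡⟨ cong₂ ℚ._+_ (powerValue-risingPoly n) (evalBasis-* p R (powerSlope r)) ⟩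
           ρ ℚ.+ R ℚ.* d ∎) ⟩
    ρ ℚ.+ R ℚ.* d ℚ.+ A ℚ.* d
      ≡⟨ cong (λ h → ρ ℚ.+ R ℚ.* h ℚ.+ A ℚ.* h) (powerSlope-risingPoly n) ⟩
    ρ ℚ.+ R ℚ.* X ℚ.+ A ℚ.* X
      ≡⟨ solve 4 (λ ρ R A X → ρ :+ R :* X :+ A :* X := (R :+ A) :* X :+ ρ) refl ρ R A X ⟩
    (R ℚ.+ A) ℚ.* X ℚ.+ ρ
      ≡⟨ cong (λ z → z ℚ.* X ℚ.+ ρ) (sym (ℕ→ℚ-+-assoc n)) ⟩
    ℕ→ℚ (r ℕ.+ m ℕ.+ n) ℚ.* X ℚ.+ ρ
      ≡⟨ sym (factorialHH-recurrence (r ℕ.+ m) n) ⟩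
    factorialHH (r ℕ.+ m) (suc n) ∎
    where
    p = risingPoly m n; d = evalBasis (powerSlope r) p; R = ℕ→ℚ r; A = ℕ→ℚ (m ℕ.+ n)
    ρ = ℕ→ℚ (rising (r ℕ.+ m) n); X = factorialHH (r ℕ.+ m) n

stirling2-hyperharmonic-sum : ∀ n m r →
  sumℚ (suc n) (λ k → sign (suc k) ℚ.* ℕ→ℚ (stirling2 m (suc n) k) ℚ.* ℕ→ℚ (k !) ℚ.* hh r k)
    ≡ ℕ→ℚ (suc n) ℚ.* ℤ→ℚ ((+ m ℤ.- + r) ℤ.^ n)
stirling2-hyperharmonic-sum n m r = begin
  sumℚ (suc n) (λ k → sign (suc k) ℚ.* ℕ→ℚ (coeff p k) ℚ.* ℕ→ℚ (k !) ℚ.* hh r k)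
    ≡⟨ sumℚ-cong (suc n) (λ k → solve 4 (λ σ c f h → σ :* c :* f :* h := c :* (σ :* (f :* h))) refl
         (sign (suc k)) (ℕ→ℚ (coeff p k)) (ℕ→ℚ (k !)) (hh r k)) ⟩
  sumℚ (suc n) (λ k → ℕ→ℚ (coeff p k) ℚ.* fallingSlope r k)
    ≡⟨ sum≡evalBasis p (fallingSlope r) (suc n) (fallingSlope-zero r) (length-powFalling m (suc n)) ⟩
  evalBasis (fallingSlope r) p
    ≡⟨ fallingSlope-powFalling r m n ⟩
  ℕ→ℚ (suc n) ℚ.* ℤ→ℚ ((+ m ℤ.- + r) ℤ.^ n) ∎
  where p = powFalling m (suc n)

stirling1-power-sum : ∀ n m r →
  ℕ→ℚ (sumℕ n (λ k → k ℕ.* stirling1 m n k ℕ.* (r ℕ.^ (k ∸ 1)))) ≡ ℕ→ℚ (n !) ℚ.* hh (r ℕ.+ m) n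
stirling1-power-sum n m r = begin
  ℕ→ℚ (sumℕ n (λ k → k ℕ.* coeff p k ℕ.* (r ℕ.^ (k ∸ 1))))
    ≡⟨ ℕ→ℚ-sumℕ n _ ⟩
  sumℚ n (λ k → ℕ→ℚ (k ℕ.* coeff p k ℕ.* (r ℕ.^ (k ∸ 1))))
    ≡⟨ sumℚ-cong n (λ k → trans (cong ℕ→ℚ (swap k (coeff p k) (r ℕ.^ (k ∸ 1)))) (ℕ→ℚ-* (coeff p k) _)) ⟩
  sumℚ n (λ k → ℕ→ℚ (coeff p k) ℚ.* powerSlope r k)
    ≡⟨ sum≡evalBasis p (powerSlope r) n refl (length-risingPoly m n) ⟩
  evalBasis (powerSlope r) p
    ≡⟨ powerSlope-risingPoly r m n ⟩
  ℕ→ℚ (n !) ℚ.* hh (r ℕ.+ m) n ∎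
  where
  p = risingPoly m n
  swap : ∀ a b c → a ℕ.* b ℕ.* c ≡ b ℕ.* (a ℕ.* c)
  swap = solve-∀

mainTheorem17 : (n m r : ℕ) → n ≥ 1 →
    (sumℚ n (λ k → sign (suc k) ℚ.* ℕ→ℚ (stirling2 m n k) ℚ.* ℕ→ℚ (k !) ℚ.* hh r k)
       ≡ ℕ→ℚ n ℚ.* ℤ→ℚ ((+ m ℤ.- + r) ℤ.^ (n ∸ 1)))
    ×
    (ℕ→ℚ (sumℕ n (λ k → k ℕ.* stirling1 m n k ℕ.* (r ℕ.^ (k ∸ 1))))
       ≡ ℕ→ℚ (n !) ℚ.* hh (r ℕ.+ m) n)
mainTheorem17 (suc n) m r _ = stirling2-hyperharmonic-sum n m r , stirling1-power-sum (suc n) m r
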